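{- Let $T$ be a tree and let $v$ be a vertex of $T$. If $T$ has a consistent range-relaxed graceful labeling $f$ with $f(v)=0$, then there exists $N$ such that, for all $k\ge N$, the tree obtained from $T$ by attaching $k$ new leaves at $v$ is graceful.
   Context: A labeling of a tree $T$ is an injective map $f$ from the vertices of $T$ to the non-negative integers; the induced label of an edge $xy$ is $|f(x)-f(y)|$. The labeling is range-relaxed graceful if the induced edge labels are pairwise distinct. Writing $V_f$ for the set of vertex labels and $E_f$ for the set of induced edge labels, a range-relaxed graceful labeling is consistent if $V_f=E_f\cup\{0\}$. A tree with $n$ edges is graceful if there is an injective map from its vertices to $\{0,\ldots,n\}$ whose induced edge labels are exactly $\{1,\ldots,n\}$. -}

module Defs where

open import Data.Nat using (ℕ; zero; suc; _+_; _≤_; ∣_-_∣)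
open import Data.Fin using (Fin; _↑ˡ_; _↑ʳ_; splitAt)
open import Data.Product using (Σ; ∃; _×_; _,_; proj₁; proj₂)
open import Data.Sum using (_⊎_; inj₁; inj₂)
open import Relation.Binary.PropositionalEquality using (_≡_; _≢_)
open import Relation.Nullary using (¬_)
open import Function.Definitions using (Injective)

record Graph : Set where
  field
    V    : ℕ
    E    : ℕ
    ends : Fin E → Fin V × Fin V

open Graph public

SamePair : ∀ {V} → Fin V × Fin V → Fin V × Fin V → Set
SamePair (a , b) (c , d) = (a ≡ c × b ≡ d) ⊎ (a ≡ d × b ≡ c)

IsSimple : Graph → Set
IsSimple G = (∀ i → proj₁ (ends G i) ≢ proj₂ (ends G i))
           × (∀ i j → SamePair (ends G i) (ends G j) → i ≡ j)

data Walk (G : Graph) : Fin (V G) → Fin (V G) → Set where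
  here : ∀ {u} → Walk G u u
  fwd  : ∀ {u w} (i : Fin (E G)) → proj₁ (ends G i) ≡ u → Walk G (proj₂ (ends G i)) w → Walk G u w
  bwd  : ∀ {u w} (i : Fin (E G)) → proj₂ (ends G i) ≡ u → Walk G (proj₁ (ends G i)) w → Walk G u w

IsConnected : Graph → Set
IsConnected G = ∀ u w → Walk G u w

record Tree : Set where
  field
    graph     : Graph
    size      : V graph ≡ suc (E graph)
    simple    : IsSimple graph
    connected : IsConnected graph

open Tree public

edgeLabel : (G : Graph) → (Fin (V G) → ℕ) → Fin (E G) → ℕ
edgeLabel G f i = ∣ f (proj₁ (ends G i)) - f (proj₂ (ends G i)) ∣

RangeRelaxedGraceful : (G : Graph) → (Fin (V G) → ℕ) → Set
RangeRelaxedGraceful G f = Injective _≡_ _≡_ f × Injective _≡_ _≡_ (edgeLabel G f)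

Consistent : (G : Graph) → (Fin (V G) → ℕ) → Set
Consistent G f = ∀ a → ((∃ λ x → f x ≡ a) → (a ≡ 0 ⊎ ∃ λ i → edgeLabel G f i ≡ a))
                     × ((a ≡ 0 ⊎ ∃ λ i → edgeLabel G f i ≡ a) → ∃ λ x → f x ≡ a)

Graceful : Graph → Set
Graceful G = Σ (Fin (V G) → ℕ) λ f →
    Injective _≡_ _≡_ f
  × (∀ x → f x ≤ E G)
  × (∀ a → ((∃ λ i → edgeLabel G f i ≡ a) → (1 ≤ a × a ≤ E G))
         × ((1 ≤ a × a ≤ E G) → ∃ λ i → edgeLabel G f i ≡ a))

-- attach k new leaves at vertex v: vertices Fin (V + k) (old vertices
-- first, new leaves last), edges Fin (E + k) (old edges first, then
-- the k new edges v — leaf j)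
attachLeaves : (G : Graph) → Fin (V G) → ℕ → Graph
attachLeaves G v k = record
  { V = V G + k
  ; E = E G + k
  ; ends = λ i → go (splitAt (E G) i)
  }
  where
    go : Fin (E G) ⊎ Fin k → Fin (V G + k) × Fin (V G + k)
    go (inj₁ i) = (proj₁ (ends G i)) ↑ˡ k , (proj₂ (ends G i)) ↑ˡ k
    go (inj₂ j) = v ↑ˡ k , V G ↑ʳ j

module Submission where

-- Let T have E edges and let f be injective and consistent with
-- f v = 0. Once k is at least every label of f, all labels of f lie in
-- {0,…,E+k}, and since T has E+1 vertices exactly k numbers of that range
-- are missed by f. Give the k new leaves these missing numbers. Each new
-- edge v — leaf then carries the label of its leaf (because f v = 0), each
-- old edge keeps its label, and by consistency the old edge labels are the
-- non-zero labels of f. Hence the edge labels are exactly {1,…,E+k}.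

open import Defs
open import Data.Nat using (ℕ; zero; suc; _+_; _≤_; _<_; s≤s; _⊔_; ∣_-_∣)
open import Data.Nat.Properties
  using (_≟_; ≤-refl; ≤-trans; ≤-pred; <-irrefl; m≤n⇒m≤1+n; m<1+n⇒m<n∨m≡n; m≤m⊔n; m≤n⊔m;
         m≤n+m; +-identityʳ; +-suc; suc-injective; n≢0⇒n>0; ∣m-n∣≡0⇒m≡n; ≤⇒≯)
open import Data.Fin using (Fin; _↑ˡ_; _↑ʳ_; splitAt; join; punchIn; punchOut; fromℕ<; toℕ)
open import Data.Fin.Properties
  using (splitAt-↑ˡ; splitAt-↑ʳ; splitAt⁻¹-↑ˡ; splitAt⁻¹-↑ʳ; join-splitAt;
         punchIn-injective; punchInᵢ≢i; punchIn-punchOut; toℕ-fromℕ<; injective⇒≤; any?; ¬Fin0)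
  renaming (_≟_ to _≟ᶠ_)
open import Data.Product using (∃; _×_; _,_; proj₁; proj₂)
open import Data.Sum using (_⊎_; inj₁; inj₂; [_,_]′; map₁; map₂)
open import Data.Empty using (⊥-elim)
open import Function using (_∘_)
open import Function.Definitions using (Injective)
open import Relation.Nullary using (yes; no)
open import Relation.Binary.PropositionalEquality
  using (_≡_; _≢_; refl; sym; trans; cong; cong₂; subst; module ≡-Reasoning)

injective-below⇒≤ : ∀ {m L} (h : Fin m → ℕ) → Injective _≡_ _≡_ h → (∀ i → h i < L) → m ≤ L
injective-below⇒≤ h h-inj h<L = injective⇒≤ {f = λ i → fromℕ< (h<L i)} λ {i} {j} eq →
  h-inj (trans (sym (toℕ-fromℕ< (h<L i))) (trans (cong toℕ eq) (toℕ-fromℕ< (h<L j))))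

record Complement {m : ℕ} (L : ℕ) (h : Fin m → ℕ) (k : ℕ) : Set where
  field
    value     : Fin k → ℕ
    injective : Injective _≡_ _≡_ value
    bounded   : ∀ j → value j < L
    disjoint  : ∀ i j → h i ≢ value j
    covering  : ∀ a → a < L → (∃ λ i → h i ≡ a) ⊎ (∃ λ j → value j ≡ a)

complement-attained : ∀ {m L k} (h : Fin (suc m) → ℕ) (i : Fin (suc m)) → h i ≡ L
                    → Complement L (h ∘ punchIn i) k → Complement (suc L) h k
complement-attained {L = L} h i hi≡L C = record
  { value = value ; injective = injective ; bounded = m≤n⇒m≤1+n ∘ bounded
  ; disjoint = disjoint′ ; covering = covering′ }
  where
  open Complement C
  disjoint′ : ∀ i′ j → h i′ ≢ value j
  disjoint′ i′ j eq with i ≟ᶠ i′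
  ... | yes refl = <-irrefl (trans (sym eq) hi≡L) (bounded j)
  ... | no i≢i′ = disjoint (punchOut i≢i′) j (trans (cong h (punchIn-punchOut i≢i′)) eq)
  covering′ : ∀ a → a < suc L → (∃ λ i′ → h i′ ≡ a) ⊎ (∃ λ j → value j ≡ a)
  covering′ a a<1+L with m<1+n⇒m<n∨m≡n a<1+L
  ... | inj₂ refl = inj₁ (i , hi≡L)
  ... | inj₁ a<L  = map₁ (λ (i′ , eq) → punchIn i i′ , eq) (covering a a<L)

complement-missed : ∀ {m L k} (h : Fin m → ℕ) → (∀ i → h i ≢ L)
                  → Complement L h k → Complement (suc L) h (suc k)
complement-missed {L = L} {k} h h≢L C = record
  { value = value′ ; injective = injective′ ; bounded = bounded′
  ; disjoint = disjoint′ ; covering = covering′ }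
  where
  open Complement C
  value′ : Fin (suc k) → ℕ
  value′ Fin.zero    = L
  value′ (Fin.suc j) = value j
  injective′ : Injective _≡_ _≡_ value′
  injective′ {Fin.zero}  {Fin.zero}  _  = refl
  injective′ {Fin.zero}  {Fin.suc j} eq = ⊥-elim (<-irrefl (sym eq) (bounded j))
  injective′ {Fin.suc i} {Fin.zero}  eq = ⊥-elim (<-irrefl eq (bounded i))
  injective′ {Fin.suc i} {Fin.suc j} eq = cong Fin.suc (injective eq)
  bounded′ : ∀ j → value′ j < suc L
  bounded′ Fin.zero    = ≤-refl
  bounded′ (Fin.suc j) = m≤n⇒m≤1+n (bounded j)
  disjoint′ : ∀ i j → h i ≢ value′ j
  disjoint′ i Fin.zero    = h≢L i
  disjoint′ i (Fin.suc j) = disjoint i j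
  covering′ : ∀ a → a < suc L → (∃ λ i → h i ≡ a) ⊎ (∃ λ j → value′ j ≡ a)
  covering′ a a<1+L with m<1+n⇒m<n∨m≡n a<1+L
  ... | inj₂ refl = inj₂ (Fin.zero , refl)
  ... | inj₁ a<L  = map₂ (λ (j , eq) → Fin.suc j , eq) (covering a a<L)

below-after-removal : ∀ {m L} (h : Fin (suc m) → ℕ) → Injective _≡_ _≡_ h → (∀ i → h i < suc L)
                    → (i : Fin (suc m)) → h i ≡ L → ∀ j → h (punchIn i j) < L
below-after-removal h h-inj h<1+L i hi≡L j with m<1+n⇒m<n∨m≡n (h<1+L (punchIn i j))
... | inj₁ below = below
... | inj₂ eq    = ⊥-elim (punchInᵢ≢i i j (h-inj (trans eq (sym hi≡L))))

below-if-missed : ∀ {m L} (h : Fin m → ℕ) → (∀ i → h i < suc L) → (∀ i → h i ≢ L) → ∀ i → h i < L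
below-if-missed h h<1+L h≢L i with m<1+n⇒m<n∨m≡n (h<1+L i)
... | inj₁ below = below
... | inj₂ eq    = ⊥-elim (h≢L i eq)

-- Induction on the bound: for the bound L + 1, either h attains
-- L (remove it) or it does not (L becomes a complement value).
complement : ∀ L {m} k (h : Fin m → ℕ) → m + k ≡ L → Injective _≡_ _≡_ h → (∀ i → h i < L)
           → Complement L h k
complement zero {zero} zero h refl h-inj h<L = record
  { value = λ () ; injective = λ {i} → ⊥-elim (¬Fin0 i)
  ; bounded = λ () ; disjoint = λ () ; covering = λ a () }
complement (suc L) {m} k h m+k≡L h-inj h<L with any? (λ i → h i ≟ L)
complement (suc L) {zero}  k h m+k≡L h-inj h<L | yes (() , _)
complement (suc L) {suc m} k h m+k≡L h-inj h<L | yes (i , hi≡L) =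
  complement-attained h i hi≡L
    (complement L k (h ∘ punchIn i) (suc-injective m+k≡L)
                (λ {a} {b} → punchIn-injective i a b ∘ h-inj)
                (below-after-removal h h-inj h<L i hi≡L))
complement (suc L) {m} zero h m+0≡L h-inj h<L | no missed =
  ⊥-elim (≤⇒≯ (injective-below⇒≤ h h-inj (below-if-missed h h<L h≢L))
              (subst (L <_) (trans (sym m+0≡L) (+-identityʳ m)) ≤-refl))
  where
  -- with L missed, m distinct values fit below L, contradicting m = L + 1
  h≢L : ∀ i → h i ≢ L
  h≢L i eq = missed (i , eq)
complement (suc L) {m} (suc k) h m+1+k≡L h-inj h<L | no missed =
  complement-missed h h≢L
    (complement L k h (suc-injective (trans (sym (+-suc m k)) m+1+k≡L)) h-inj
                (below-if-missed h h<L h≢L))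
  where
  h≢L : ∀ i → h i ≢ L
  h≢L i eq = missed (i , eq)

↑-cases : ∀ {m n} (P : Fin (m + n) → Set) → (∀ i → P (i ↑ˡ n)) → (∀ j → P (m ↑ʳ j)) → ∀ x → P x
↑-cases {m} P left right x with splitAt m x in eq
... | inj₁ i = subst P (splitAt⁻¹-↑ˡ eq) (left i)
... | inj₂ j = subst P (splitAt⁻¹-↑ʳ eq) (right j)

glue : ∀ {m n} → (Fin m → ℕ) → (Fin n → ℕ) → Fin (m + n) → ℕ
glue {m} f c x = [ f , c ]′ (splitAt m x)

glue-↑ˡ : ∀ {m n} (f : Fin m → ℕ) (c : Fin n → ℕ) i → glue f c (i ↑ˡ n) ≡ f i
glue-↑ˡ {m} {n} f c i = cong [ f , c ]′ (splitAt-↑ˡ m i n)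

glue-↑ʳ : ∀ {m n} (f : Fin m → ℕ) (c : Fin n → ℕ) j → glue f c (m ↑ʳ j) ≡ c j
glue-↑ʳ {m} {n} f c j = cong [ f , c ]′ (splitAt-↑ʳ m n j)

glue-injective : ∀ {m n} (f : Fin m → ℕ) (c : Fin n → ℕ)
               → Injective _≡_ _≡_ f → Injective _≡_ _≡_ c → (∀ i j → f i ≢ c j)
               → Injective _≡_ _≡_ (glue f c)
glue-injective {m} {n} f c f-inj c-inj disjoint {x} {y} eq = begin
  x                     ≡⟨ sym (join-splitAt m n x) ⟩
  join m n (splitAt m x) ≡⟨ cong (join m n) (sum-injective {splitAt m x} {splitAt m y} eq) ⟩
  join m n (splitAt m y) ≡⟨ join-splitAt m n y ⟩
  y                     ∎
  where
  open ≡-Reasoning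
  sum-injective : ∀ {s t} → [ f , c ]′ s ≡ [ f , c ]′ t → s ≡ t
  sum-injective {inj₁ i} {inj₁ i′} eq = cong inj₁ (f-inj eq)
  sum-injective {inj₁ i} {inj₂ j}  eq = ⊥-elim (disjoint i j eq)
  sum-injective {inj₂ j} {inj₁ i}  eq = ⊥-elim (disjoint i j (sym eq))
  sum-injective {inj₂ j} {inj₂ j′} eq = cong inj₂ (c-inj eq)

glue-bounded : ∀ {m n B} (f : Fin m → ℕ) (c : Fin n → ℕ)
             → (∀ i → f i ≤ B) → (∀ j → c j ≤ B) → ∀ x → glue f c x ≤ B
glue-bounded {m} {B = B} f c f≤B c≤B = ↑-cases (λ x → glue f c x ≤ B)
  (λ i → subst (_≤ B) (sym (glue-↑ˡ f c i)) (f≤B i))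
  (λ j → subst (_≤ B) (sym (glue-↑ʳ f c j)) (c≤B j))

module _ (G : Graph) (v : Fin (V G)) {k : ℕ} (f : Fin (V G) → ℕ) (c : Fin k → ℕ) where

  private
    g : Fin (V G + k) → ℕ
    g = glue f c

  attached-old-label : ∀ e → edgeLabel (attachLeaves G v k) g (e ↑ˡ k) ≡ edgeLabel G f e
  attached-old-label e rewrite splitAt-↑ˡ (E G) e k =
    cong₂ ∣_-_∣ (glue-↑ˡ f c (proj₁ (ends G e))) (glue-↑ˡ f c (proj₂ (ends G e)))

  attached-new-label : f v ≡ 0 → ∀ j → edgeLabel (attachLeaves G v k) g (E G ↑ʳ j) ≡ c j
  attached-new-label fv≡0 j rewrite splitAt-↑ʳ (E G) k j =
    cong₂ ∣_-_∣ (trans (glue-↑ˡ f c v) fv≡0) (glue-↑ʳ f c j)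

  attached-label-cases : f v ≡ 0 → ∀ a → (∃ λ i → edgeLabel (attachLeaves G v k) g i ≡ a)
                       → (∃ λ e → edgeLabel G f e ≡ a) ⊎ (∃ λ j → c j ≡ a)
  attached-label-cases fv≡0 a (i , label≡a) = ↑-cases Cases
    (λ e label≡a → inj₁ (e , trans (sym (attached-old-label e)) label≡a))
    (λ j label≡a → inj₂ (j , trans (sym (attached-new-label fv≡0 j)) label≡a))
    i label≡a
    where
    Cases : Fin (E G + k) → Set
    Cases i = edgeLabel (attachLeaves G v k) g i ≡ a
            → (∃ λ e → edgeLabel G f e ≡ a) ⊎ (∃ λ j → c j ≡ a)

edgeLabel-positive : (G : Graph) (f : Fin (V G) → ℕ) → IsSimple G → Injective _≡_ _≡_ f
                   → ∀ e → 1 ≤ edgeLabel G f e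
edgeLabel-positive G f (loopless , _) f-inj e = n≢0⇒n>0 (loopless e ∘ f-inj ∘ ∣m-n∣≡0⇒m≡n)

upper-bound : ∀ m (h : Fin m → ℕ) → ∃ λ B → ∀ i → h i ≤ B
upper-bound zero    h = 0 , λ ()
upper-bound (suc m) h with upper-bound m (h ∘ Fin.suc)
... | B , h∘suc≤B = h Fin.zero ⊔ B , λ
  { Fin.zero    → m≤m⊔n (h Fin.zero) B
  ; (Fin.suc i) → ≤-trans (h∘suc≤B i) (m≤n⊔m (h Fin.zero) B) }

attached-graceful : (T : Tree) (v : Fin (V (graph T))) (f : Fin (V (graph T)) → ℕ) (k : ℕ)
                  → Injective _≡_ _≡_ f → Consistent (graph T) f → f v ≡ 0
                  → (∀ x → f x ≤ E (graph T) + k) → Graceful (attachLeaves (graph T) v k)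
attached-graceful T v f k f-inj consistent fv≡0 f≤E+k =
  glue f value ,
  glue-injective f value f-inj injective disjoint ,
  glue-bounded f value f≤E+k (≤-pred ∘ bounded) ,
  λ a → sound a , complete a
  where
  G = graph T
  -- V G + k = E G + k + 1, so exactly k numbers up to E G + k are missed by f.
  open Complement (complement (suc (E G + k)) k f (cong (_+ k) (size T)) f-inj (s≤s ∘ f≤E+k))

  EdgeLabel : ℕ → Set
  EdgeLabel a = ∃ λ i → edgeLabel (attachLeaves G v k) (glue f value) i ≡ a

  -- Old labels are positive and, being vertex labels, at most E + k;
  -- leaf labels are below E + k + 1 and differ from f v = 0.
  sound : ∀ a → EdgeLabel a → 1 ≤ a × a ≤ E G + k
  sound a labelled with attached-label-cases G v f value fv≡0 a labelled
  ... | inj₁ (e , label≡a) with proj₂ (consistent a) (inj₂ (e , label≡a))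
  ...   | x , fx≡a = subst (1 ≤_) label≡a (edgeLabel-positive G f (simple T) f-inj e)
                   , subst (_≤ E G + k) fx≡a (f≤E+k x)
  sound a labelled | inj₂ (j , cj≡a) =
    n≢0⇒n>0 (λ a≡0 → disjoint v j (trans fv≡0 (sym (trans cj≡a a≡0))))
    , subst (_≤ E G + k) cj≡a (≤-pred (bounded j))

  -- A number in {1,…,E+k} is a leaf label, or a non-zero vertex label and
  -- hence, by consistency, an old edge label.
  complete : ∀ a → 1 ≤ a × a ≤ E G + k → EdgeLabel a
  complete a (1≤a , a≤E+k) with covering a (s≤s a≤E+k)
  ... | inj₂ (j , cj≡a) = E G ↑ʳ j , trans (attached-new-label G v f value fv≡0 j) cj≡a
  ... | inj₁ (x , fx≡a) with proj₁ (consistent a) (x , fx≡a)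
  ...   | inj₁ refl          = ⊥-elim (<-irrefl refl 1≤a)
  ...   | inj₂ (e , label≡a) = e ↑ˡ k , trans (attached-old-label G v f value e) label≡a

mainTheorem11 : (T : Tree) (v : Fin (V (graph T))) (f : Fin (V (graph T)) → ℕ)
                → RangeRelaxedGraceful (graph T) f
                → Consistent (graph T) f
                → f v ≡ 0
                → ∃ λ N → ∀ k → N ≤ k → Graceful (attachLeaves (graph T) v k)
mainTheorem11 T v f (f-inj , _) consistent fv≡0 =
  let (B , f≤B) = upper-bound (V (graph T)) f
      f≤E+k : ∀ k → B ≤ k → ∀ x → f x ≤ E (graph T) + k
      f≤E+k k B≤k x = ≤-trans (f≤B x) (≤-trans B≤k (m≤n+m k (E (graph T))))
  in B , λ k B≤k → attached-graceful T v f k f-inj consistent fv≡0 (f≤E+k k B≤k)
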